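{- Let $G=(V,E)$ be a strongly connected $d$-out digraph, let $S=\langle R_1,\ldots,R_d\rangle$ be a coloring semigroup of $G$ with kernel $\mathcal K$, and let $\mathcal E$ be the equivalence relation on $V$ given by: $x\,\mathcal E\,y$ iff $x$ and $y$ lie in the same block of the partition induced by every element of $\mathcal K$ (equivalently, $\mathcal E=\bigcap_N \mathcal E_N$, where $N$ ranges over the minimal right ideals $N\mathcal K$ of $\mathcal K$ and $\mathcal E_N$ is the equivalence relation of the common partition $\Pi_N$ induced by the elements of $N\mathcal K$). Then for all $x,y\in V$, $x\,\mathcal E\,y$ if and only if $x\equiv_S y$.
   Context: A $d$-out digraph has every vertex of out-degree $d$ (multiple edges allowed). A coloring is a decomposition of the adjacency matrix $\mathcal A=R_1+\cdots+R_d$ into 0-1 stochastic matrices, each identified with a map $V\to V$ ($j R_i=k$ iff $(R_i)_{jk}=1$; maps act on the right). The coloring semigroup $S=\langle R_1,\ldots,R_d\rangle$ is the finite semigroup they generate under composition; its kernel $\mathcal K$ is its minimal ideal. Each $K\in\mathcal K$ induces the partition of $V$ into its nonempty fibers $\{i: iK=j\}$. The stability relation: $x\equiv_S y$ iff for every $W_1\in S$ there exists $W_2\in S$ with $xW_1W_2=yW_1W_2$. -}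

module Defs where

open import Data.Nat using (ℕ)
open import Data.Fin using (Fin)
open import Data.Vec using (Vec; lookup; tabulate)
open import Data.Product using (Σ; ∃; _×_; _,_)
open import Relation.Binary.PropositionalEquality using (_≡_)
open import Relation.Binary.Construct.Closure.ReflexiveTransitive using (Star)

-- A self-map of the vertex set V = Fin n, stored as its table of values
-- (so that propositional equality of maps is extensional).
Map : ℕ → Set
Map n = Vec (Fin n) n

_·_ : ∀ {n} → Fin n → Map n → Fin n
x · f = lookup f x

_⨾_ : ∀ {n} → Map n → Map n → Map n
f ⨾ g = tabulate (λ x → (x · f) · g)

-- The digraph is determined by the coloring: edge multiplicity from j to k is
-- the number of i with j R_i = k, so every vertex has out-degree exactly d.
Coloring : ℕ → ℕ → Set
Coloring n d = Fin d → Map n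

Edge : ∀ {n d} → Coloring n d → Fin n → Fin n → Set
Edge {d = d} R x y = Σ (Fin d) λ i → x · R i ≡ y

StronglyConnected : ∀ {n d} → Coloring n d → Set
StronglyConnected {n} R = (x y : Fin n) → Star (Edge R) x y

data InS {n d} (R : Coloring n d) : Map n → Set where
  gen  : (i : Fin d) → InS R (R i)
  comp : ∀ {f g} → InS R f → InS R g → InS R (f ⨾ g)

record IsIdeal {n d} (R : Coloring n d) (I : Map n → Set) : Set where
  field
    sub      : ∀ f → I f → InS R f
    nonempty : ∃ λ f → I f
    closedˡ  : ∀ s k → InS R s → I k → I (s ⨾ k)
    closedʳ  : ∀ s k → InS R s → I k → I (k ⨾ s)

record IsKernel {n d} (R : Coloring n d) (K : Map n → Set) : Set₁ where
  field
    ideal   : IsIdeal R K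
    minimal : ∀ (J : Map n → Set) → IsIdeal R J → (∀ f → J f → K f) → ∀ f → K f → J f

KerRel : ∀ {n} → (Map n → Set) → Fin n → Fin n → Set
KerRel {n} K x y = ∀ (k : Map n) → K k → x · k ≡ y · k

Stable : ∀ {n d} → Coloring n d → Fin n → Fin n → Set
Stable {n} R x y =
  ∀ (W₁ : Map n) → InS R W₁ →
    ∃ λ (W₂ : Map n) → InS R W₂ × (x · (W₁ ⨾ W₂) ≡ y · (W₁ ⨾ W₂))

module Submission where

-- Kernel partition = stability.
--
-- (⇒) If every kernel element identifies x and y, take any k₀ ∈ 𝓚: for each
--     W₁ ∈ S the product W₁k₀ again lies in the ideal 𝓚, so W₂ = k₀ works.
-- (⇐) Let k ∈ 𝓚 and let W₂ ∈ S stabilise x, y after W₁ = k.  Then m = kW₂ ∈ 𝓚,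
--     and minimality of 𝓚 forces k = a m b for some a, b ∈ S (the elements of
--     𝓚 of this shape form an ideal).  Hence z·k = t((z·a)·k) with t w = (w·W₂)·b:
--     the map t sends the finite set Im k onto itself, so it is injective there.
--     Since t(x·k) = t(y·k), we get x·k = y·k.

open import Defs
open import Data.Nat using (ℕ; zero; suc)
open import Data.Nat.Properties using (1+n≰n)
open import Data.Fin using (Fin; _≟_; punchOut)
open import Data.Fin.Properties using (injective⇒≤; punchOut-injective; any?)
open import Data.List using (List; length; filter; allFin)
import Data.List as List
open import Data.List.Relation.Unary.All as All using ()
open import Data.List.Relation.Unary.AllPairs using (_∷_)
open import Data.List.Relation.Unary.Unique.Propositional using (Unique)
open import Data.List.Relation.Unary.Unique.Propositional.Properties using (filter⁺; allFin⁺)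
open import Data.List.Membership.Propositional using (_∈_)
open import Data.List.Membership.Propositional.Properties using (∈-filter⁺; ∈-filter⁻; ∈-lookup; ∈-allFin)
open import Data.List.Relation.Unary.Any using (index)
open import Data.List.Relation.Unary.Any.Properties using (lookup-index)
open import Data.Vec.Properties using (lookup∘tabulate; tabulate-cong)
open import Data.Product using (Σ; ∃; _×_; _,_; proj₁; proj₂)
open import Data.Empty using (⊥-elim)
open import Function.Base using (_∘_)
open import Function.Bundles using (_⇔_; mk⇔)
open import Relation.Nullary using (yes; no; ¬_)
open import Relation.Unary using (Decidable)
open import Relation.Binary.PropositionalEquality

lookup-injective : ∀ {A : Set} {xs : List A} → Unique xs →
                   ∀ {i j} → List.lookup xs i ≡ List.lookup xs j → i ≡ j
lookup-injective (_ ∷ _)    {Fin.zero}  {Fin.zero}  _  = refl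
lookup-injective (px ∷ _)   {Fin.zero}  {Fin.suc j} eq = ⊥-elim (All.lookup px (∈-lookup j) eq)
lookup-injective (px ∷ _)   {Fin.suc i} {Fin.zero}  eq = ⊥-elim (All.lookup px (∈-lookup i) (sym eq))
lookup-injective (_ ∷ uniq) {Fin.suc i} {Fin.suc j} eq = cong Fin.suc (lookup-injective uniq eq)

-- If F i₁ = F i₂ with i₁ ≠ i₂, then choosing preimages of the e j
-- while avoiding i₂ gives an injection Fin m → Fin m ∖ {i₂}, impossible.
covering⇒injective : ∀ {A : Set} {m} (F e : Fin m → A) →
                     (∀ {i j} → e i ≡ e j → i ≡ j) →
                     (∀ j → ∃ λ i → F i ≡ e j) →
                     ∀ i₁ i₂ → F i₁ ≡ F i₂ → i₁ ≡ i₂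
covering⇒injective {m = zero}  F e e-inj cover () i₂ eq
covering⇒injective {m = suc m} F e e-inj cover i₁ i₂ eq with i₁ ≟ i₂
... | yes i₁≡i₂ = i₁≡i₂
... | no  i₁≢i₂ = ⊥-elim (1+n≰n (injective⇒≤ punched-injective))
  where
  avoiding : ∀ j → Σ (Fin (suc m)) λ i → ¬ i₂ ≡ i × F i ≡ e j
  avoiding j with cover j
  ... | i , Fi≡ej with i ≟ i₂
  ...   | yes refl = i₁ , (λ i₂≡i₁ → i₁≢i₂ (sym i₂≡i₁)) , trans eq Fi≡ej
  ...   | no  i≢i₂ = i , (λ i₂≡i → i≢i₂ (sym i₂≡i)) , Fi≡ej

  preimage : Fin (suc m) → Fin (suc m)
  preimage j = proj₁ (avoiding j)

  preimage-avoids : ∀ j → ¬ i₂ ≡ preimage j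
  preimage-avoids j = proj₁ (proj₂ (avoiding j))

  preimage-injective : ∀ {j₁ j₂} → preimage j₁ ≡ preimage j₂ → j₁ ≡ j₂
  preimage-injective {j₁} {j₂} same =
    e-inj (trans (sym (proj₂ (proj₂ (avoiding j₁)))) (trans (cong F same) (proj₂ (proj₂ (avoiding j₂)))))

  punched : Fin (suc m) → Fin m
  punched j = punchOut (preimage-avoids j)

  punched-injective : ∀ {j₁ j₂} → punched j₁ ≡ punched j₂ → j₁ ≡ j₂
  punched-injective {j₁} {j₂} same =
    preimage-injective (punchOut-injective (preimage-avoids j₁) (preimage-avoids j₂) same)

-- Enumerate the (finite, decidable) image without
-- repetitions and apply covering⇒injective.
onto-image⇒injective : ∀ {n} (k t : Fin n → Fin n) →
                       (∀ x → ∃ λ x' → t (k x') ≡ k x) →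
                       ∀ x y → t (k x) ≡ t (k y) → k x ≡ k y
onto-image⇒injective {n} k t onto x y eq =
  begin
    k x           ≡⟨ sym (e-pos x) ⟩
    e (pos x)     ≡⟨ cong e (covering⇒injective (t ∘ e) e e-injective cover (pos x) (pos y) t-eq) ⟩
    e (pos y)     ≡⟨ e-pos y ⟩
    k y
  ∎
  where
  open ≡-Reasoning
  InImage : Fin n → Set
  InImage z = ∃ λ x → k x ≡ z
  inImage? : Decidable InImage
  inImage? z = any? (λ x → k x ≟ z)

  image : List (Fin n)
  image = filter inImage? (allFin n)
  e : Fin (length image) → Fin n
  e = List.lookup image
  e-injective : ∀ {i j} → e i ≡ e j → i ≡ j
  e-injective = lookup-injective (filter⁺ inImage? (allFin⁺ n))
  e-InImage : ∀ j → InImage (e j)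
  e-InImage j = proj₂ (∈-filter⁻ inImage? {xs = allFin n} (∈-lookup j))

  listed : ∀ x → k x ∈ image
  listed x = ∈-filter⁺ inImage? (∈-allFin (k x)) (x , refl)
  pos : Fin n → Fin (length image)
  pos x = index (listed x)
  e-pos : ∀ x → e (pos x) ≡ k x
  e-pos x = sym (lookup-index (listed x))

  cover : ∀ j → ∃ λ i → t (e i) ≡ e j
  cover j with e-InImage j
  ... | x , kx≡ej with onto x
  ...   | x' , tkx'≡kx = pos x' , trans (cong t (e-pos x')) (trans tkx'≡kx kx≡ej)
  t-eq : t (e (pos x)) ≡ t (e (pos y))
  t-eq = trans (cong t (e-pos x)) (trans eq (cong t (sym (e-pos y))))

·-⨾ : ∀ {n} (x : Fin n) (f g : Map n) → x · (f ⨾ g) ≡ (x · f) · g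
·-⨾ x f g = lookup∘tabulate (λ z → (z · f) · g) x

⨾-assoc : ∀ {n} (f g h : Map n) → (f ⨾ g) ⨾ h ≡ f ⨾ (g ⨾ h)
⨾-assoc f g h = tabulate-cong λ x →
  begin
    (x · (f ⨾ g)) · h   ≡⟨ cong (_· h) (·-⨾ x f g) ⟩
    ((x · f) · g) · h   ≡⟨ sym (·-⨾ (x · f) g h) ⟩
    (x · f) · (g ⨾ h)
  ∎
  where open ≡-Reasoning

-- Any element k of the kernel is a product a m b (a, b ∈ S) around any other
-- kernel element m: the kernel elements of that shape form an ideal inside 𝓚,
-- which by minimality is all of 𝓚.
kernel-sandwich : ∀ {n d} {R : Coloring n d} {K : Map n → Set} → IsKernel R K →
                  ∀ {k m} → K k → K m →
                  ∃ λ a → ∃ λ b → InS R a × InS R b × k ≡ (a ⨾ m) ⨾ b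
kernel-sandwich {n} {R = R} {K} isK {k} {m} Kk Km =
  proj₂ (minimal Sandwiched sandwiched-ideal (λ _ → proj₁) k Kk)
  where
  open IsKernel isK
  open IsIdeal ideal
  Sandwiched : Map n → Set
  Sandwiched f = K f × ∃ λ a → ∃ λ b → InS R a × InS R b × f ≡ (a ⨾ m) ⨾ b

  m∈S : InS R m
  m∈S = sub m Km

  extendˡ : ∀ s a b → s ⨾ ((a ⨾ m) ⨾ b) ≡ ((s ⨾ a) ⨾ m) ⨾ b
  extendˡ s a b = trans (sym (⨾-assoc s (a ⨾ m) b)) (cong (_⨾ b) (sym (⨾-assoc s a m)))

  sandwiched-ideal : IsIdeal R Sandwiched
  sandwiched-ideal = record
    { sub      = λ f in-J → sub f (proj₁ in-J)
    ; nonempty = (m ⨾ m) ⨾ m , closedʳ m (m ⨾ m) m∈S (closedʳ m m m∈S Km)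
               , m , m , m∈S , m∈S , refl
    ; closedˡ  = λ { s f s∈S (Kf , a , b , a∈S , b∈S , refl) →
                     closedˡ s f s∈S Kf , s ⨾ a , b , comp s∈S a∈S , b∈S , extendˡ s a b }
    ; closedʳ  = λ { s f s∈S (Kf , a , b , a∈S , b∈S , refl) →
                     closedʳ s f s∈S Kf , a , b ⨾ s , a∈S , comp b∈S s∈S , ⨾-assoc (a ⨾ m) b s }
    }

-- (⇒) Points identified by every element of an ideal are stable: any element
-- of the ideal serves as the stabilising word.
kernelRel⇒stable : ∀ {n d} {R : Coloring n d} {K : Map n → Set} → IsIdeal R K →
                   ∀ {x y} → KerRel K x y → Stable R x y
kernelRel⇒stable {K = K} ideal related W₁ W₁∈S =
  k₀ , sub k₀ Kk₀ , related (W₁ ⨾ k₀) (closedˡ W₁ k₀ W₁∈S Kk₀)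
  where
  open IsIdeal ideal
  k₀ : Map _
  k₀ = proj₁ nonempty
  Kk₀ : K k₀
  Kk₀ = proj₂ nonempty

-- Writing k = a(kW₂)b, the map t w = (w·W₂)·b sends Im k onto
-- itself, hence is injective there, and t(x·k) = t(y·k).
kernel-cancel : ∀ {n d} {R : Coloring n d} {K : Map n → Set} → IsKernel R K →
                ∀ {k W₂ x y} → K k → InS R W₂ →
                x · (k ⨾ W₂) ≡ y · (k ⨾ W₂) → x · k ≡ y · k
kernel-cancel isK {k} {W₂} {x} {y} Kk W₂∈S identified
  with kernel-sandwich isK Kk (IsIdeal.closedʳ (IsKernel.ideal isK) W₂ k W₂∈S Kk)
... | a , b , _ , _ , k≡akW₂b =
  onto-image⇒injective (_· k) t (λ z → z · a , sym (unfold z)) x y t-identifies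
  where
  open ≡-Reasoning
  t : Fin _ → Fin _
  t w = (w · W₂) · b

  unfold : ∀ z → z · k ≡ t ((z · a) · k)
  unfold z =
    begin
      z · k                         ≡⟨ cong (z ·_) k≡akW₂b ⟩
      z · ((a ⨾ (k ⨾ W₂)) ⨾ b)      ≡⟨ ·-⨾ z (a ⨾ (k ⨾ W₂)) b ⟩
      (z · (a ⨾ (k ⨾ W₂))) · b      ≡⟨ cong (_· b) (·-⨾ z a (k ⨾ W₂)) ⟩
      ((z · a) · (k ⨾ W₂)) · b      ≡⟨ cong (_· b) (·-⨾ (z · a) k W₂) ⟩
      t ((z · a) · k)
    ∎

  t-identifies : t (x · k) ≡ t (y · k)
  t-identifies =
    cong (_· b) (trans (sym (·-⨾ x k W₂)) (trans identified (·-⨾ y k W₂)))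

stable⇒kernelRel : ∀ {n d} {R : Coloring n d} {K : Map n → Set} → IsKernel R K →
                   ∀ {x y} → Stable R x y → KerRel K x y
stable⇒kernelRel isK stable k Kk =
  let (W₂ , W₂∈S , identified) = stable k (IsIdeal.sub (IsKernel.ideal isK) k Kk)
  in  kernel-cancel isK Kk W₂∈S identified

mainTheorem2 : ∀ {n d : ℕ} (R : Coloring n d) → StronglyConnected R →
               (K : Map n → Set) → IsKernel R K →
               (x y : Fin n) → KerRel K x y ⇔ Stable R x y
mainTheorem2 R _ K isK x y =
  mk⇔ (kernelRel⇒stable (IsKernel.ideal isK)) (stable⇒kernelRel isK)
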